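{- Let $h\ge1$ be an integer and $t(\cdot)$ a polynomial. Fix a nondeterministic oracle Turing machine $N$ with running time bounded by a polynomial $p(\cdot)$, a string $x$, and sets $\mathcal{O},U_1,U_2\subseteq\{0,1\}^*$ with $\mathcal{O}\cap U_1=\mathcal{O}\cap U_2=U_1\cap U_2=\emptyset$. Let $\mathcal{L}:\mathcal{P}(\{0,1\}^*)\to\mathcal{P}(\{0,1\}^*)$ be an $(h,t)$-ambiguous (partial) function such that $\mathcal{L}(\mathcal{O}\cup A_1\cup A_2)$ is defined for all $A_1\subseteq U_1$, $A_2\subseteq U_2$ with $\|A_1\|\le h$, $\|A_2\|\le h$. Let $C_1=\{\alpha\in U_1: N^{\mathcal{L}(\mathcal{O})}(x)\text{ accepts}\iff N^{\mathcal{L}(\mathcal{O}\cup\{\alpha\})}(x)\text{ rejects}\}$ and $C_2=\{\alpha\in U_2: N^{\mathcal{L}(\mathcal{O})}(x)\text{ accepts}\iff N^{\mathcal{L}(\mathcal{O}\cup\{\alpha\})}(x)\text{ rejects}\}$. If $N^{\mathcal{L}(\mathcal{O}\cup A_1\cup A_2)}(x)$ has at most one accepting path for every $A_1\subseteq U_1$, $A_2\subseteq U_2$ with $\|A_1\|\le1$, $\|A_2\|\le1$, then $\min\{\|C_1\|,\|C_2\|\}\le 2\cdot p(|x|)\cdot t(p(|x|))\cdot\big(p(|x|)\cdot t(p(|x|))+1\big)$.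
   Context: $\mathcal{P}(S)$ is the power set of $S$, $\|S\|$ its cardinality. For $h\in\mathbb{N}^+$ and a polynomial $t$, a partial or total function $\mathcal{L}:\mathcal{P}(\{0,1\}^*)\to\mathcal{P}(\{0,1\}^*)$ is $(h,t)$-ambiguous if for all $\mathcal{O},U\subseteq\{0,1\}^*$ with $\mathcal{O}\cap U=\emptyset$, either (1) for some $A\subseteq U$ with $\|A\|\le h$, $\mathcal{L}(\mathcal{O}\cup A)$ is undefined, or (2) for every string $w$, $\|\{\alpha\in U: w\in\mathcal{L}(\mathcal{O}\cup\{\alpha\})\iff w\notin\mathcal{L}(\mathcal{O})\}\|\le t(|w|)$. $N^{S}(x)$ denotes the computation of $N$ on $x$ with oracle $S$. -}

module Defs where

open import Level using (0ℓ)
open import Data.Bool using (Bool; true; false)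
open import Data.Nat using (ℕ; zero; suc; _+_; _*_; _≤_)
open import Data.Fin using (Fin; toℕ)
open import Data.List using (List; []; _∷_; length; reverse; _++_; lookup)
open import Data.List.Relation.Unary.All using (All)
open import Data.List.Relation.Unary.Unique.Propositional using (Unique)
open import Data.List.Membership.Propositional using (_∈_)
open import Data.Product using (Σ; _×_; _,_; proj₁)
open import Data.Sum using (_⊎_)
open import Data.Empty using (⊥)
open import Relation.Nullary using (¬_)
open import Relation.Binary.PropositionalEquality using (_≡_; _≢_)
open import Relation.Unary using (Pred; _∪_; ｛_｝; _≐_)
open import Function.Bundles using (_⇔_)

Str : Set
Str = List Bool

StrSet : Set₁
StrSet = Pred Str 0ℓ

set : List Str → StrSet
set as = λ w → w ∈ as

Disjoint : StrSet → StrSet → Set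
Disjoint A B = ∀ w → A w → B w → ⊥

CardLe : StrSet → ℕ → Set
CardLe C n = (ws : List Str) → Unique ws → All C ws → length ws ≤ n

-- Polynomials with natural-number coefficients (c₀ ∷ c₁ ∷ …)

Poly : Set
Poly = List ℕ

⟦_⟧ : Poly → ℕ → ℕ
⟦ [] ⟧ n = 0
⟦ c ∷ cs ⟧ n = c + n * ⟦ cs ⟧ n

-- Partial functions P({0,1}^*) → P({0,1}^*).
-- Dom S : "L(S) is defined"; app S d : the value L(S).
-- Being a function on *sets*, L respects extensional equality of sets.

record PartialSetFun : Set₁ where
  field
    Dom      : StrSet → Set
    app      : (S : StrSet) → Dom S → StrSet
    dom-resp : ∀ {S S′} → S ≐ S′ → Dom S → Dom S′
    app-resp : ∀ {S S′} → S ≐ S′ → (d : Dom S) (d′ : Dom S′) → app S d ≐ app S′ d′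

open PartialSetFun public

Ambiguous : ℕ → Poly → PartialSetFun → Set₁
Ambiguous h t L =
  ∀ (O U : StrSet) → Disjoint O U →
    Σ (List Str) (λ A → All U A × length A ≤ h × ¬ Dom L (O ∪ set A))
    ⊎
    (∀ (w : Str) → CardLe
       (λ α → U α × Σ (Dom L O) λ d₀ → Σ (Dom L (O ∪ ｛ α ｝)) λ d →
          (app L (O ∪ ｛ α ｝) d w ⇔ (¬ app L O d₀ w)))
       (⟦ t ⟧ (length w)))

-- One work tape (initially holding the input) and one oracle (query) tape,
-- both one-way infinite to the right.  In the query state the machine asks whether the
-- string of bits written on the oracle tape (from its leftmost cell up to the
-- first non-bit symbol) is in the oracle; it then moves to state qyes / qno
-- and the oracle tape is erased.

data Sym (k : ℕ) : Set where
  blank : Sym k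
  bit   : Bool → Sym k
  extra : Fin k → Sym k

data Move : Set where
  left right stay : Move

record Tape (k : ℕ) : Set where
  constructor tape
  field
    lft  : List (Sym k)   -- cells to the left of the head, nearest first
    here : Sym k
    rgt  : List (Sym k)   -- cells to the right of the head (rest blank)

open Tape public

blankTape : ∀ {k} → Tape k
blankTape = tape [] blank []

write : ∀ {k} → Sym k → Tape k → Tape k
write a (tape l _ r) = tape l a r

move : ∀ {k} → Move → Tape k → Tape k
move left  (tape [] a r)      = tape [] a r
move left  (tape (b ∷ l) a r) = tape l b (a ∷ r)
move right (tape l a [])      = tape (a ∷ l) blank []
move right (tape l a (b ∷ r)) = tape (a ∷ l) b r
move stay  t                  = t

bitPrefix : ∀ {k} → List (Sym k) → Str
bitPrefix []            = []
bitPrefix (bit b ∷ s)   = b ∷ bitPrefix s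
bitPrefix (blank ∷ s)   = []
bitPrefix (extra _ ∷ s) = []

queryString : ∀ {k} → Tape k → Str
queryString (tape l a r) = bitPrefix (reverse l ++ (a ∷ r))

record NOTM : Set where
  field
    Q     : ℕ
    k     : ℕ
    start acc rej qry qyes qno : Fin Q
    -- transition relation: (state, work symbol, oracle symbol) ↦ list of
    -- possible (new state, written work symbol, written oracle symbol,
    --           work head move, oracle head move)
    δ : Fin Q → Sym k → Sym k → List (Fin Q × Sym k × Sym k × Move × Move)

module _ (N : NOTM) where
  open NOTM N

  record Config : Set where
    constructor conf
    field
      st : Fin Q
      wt : Tape k
      ot : Tape k

  open Config

  initConfig : Str → Config
  initConfig []      = conf start blankTape blankTape
  initConfig (b ∷ x) = conf start (tape [] (bit b) (Data.List.map bit x)) blankTape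
    where import Data.List

  options : Config → List (Fin Q × Sym k × Sym k × Move × Move)
  options c = δ (st c) (here (wt c)) (here (ot c))

  applyT : Config → (Fin Q × Sym k × Sym k × Move × Move) → Config
  applyT c (q , a , b , m₁ , m₂) =
    conf q (move m₁ (write a (wt c))) (move m₂ (write b (ot c)))

  data Step (S : StrSet) : Config → Config → Set where
    choose : ∀ {c} → st c ≢ acc → st c ≢ rej → st c ≢ qry →
             (i : Fin (length (options c))) →
             Step S c (applyT c (lookup (options c) i))
    ask-yes : ∀ {c} → st c ≡ qry → S (queryString (ot c)) →
              Step S c (conf qyes (wt c) blankTape)
    ask-no  : ∀ {c} → st c ≡ qry → ¬ S (queryString (ot c)) →
              Step S c (conf qno (wt c) blankTape)

  data Steps (S : StrSet) : Config → ℕ → Config → Set where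
    done : ∀ {c} → Steps S c 0 c
    _∷_  : ∀ {c c′ n c″} → Step S c c′ → Steps S c′ n c″ → Steps S c (suc n) c″

  data Label : Set where
    pick : ℕ → Label
    ans  : Bool → Label

  label : ∀ {S c c′} → Step S c c′ → Label
  label (choose _ _ _ i) = pick (toℕ i)
  label (ask-yes _ _)    = ans true
  label (ask-no _ _)     = ans false

  trace : ∀ {S c n c′} → Steps S c n c′ → List Label
  trace done     = []
  trace (s ∷ ss) = label s ∷ trace ss

  RunTimeBound : Poly → Set₁
  RunTimeBound p = ∀ (S : StrSet) (x : Str) (n : ℕ) (c : Config) →
                   Steps S (initConfig x) n c → n ≤ ⟦ p ⟧ (length x)

  AccPath : StrSet → Str → Set
  AccPath S x = Σ Config λ c → Σ ℕ λ n → Steps S (initConfig x) n c × st c ≡ acc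

  accTrace : ∀ {S x} → AccPath S x → List Label
  accTrace (_ , _ , ss , _) = trace ss

  Accepts : StrSet → Str → Set
  Accepts S x = AccPath S x

  AtMostOneAccPath : StrSet → Str → Set
  AtMostOneAccPath S x = (π π′ : AccPath S x) → accTrace π ≡ accTrace π′

FlipSet : NOTM → PartialSetFun → StrSet → StrSet → Str → StrSet
FlipSet N L O U x α =
  U α × Σ (Dom L O) λ d₀ → Σ (Dom L (O ∪ ｛ α ｝)) λ d →
    (Accepts N (app L O d₀) x ⇔ (¬ Accepts N (app L (O ∪ ｛ α ｝) d) x))

-- A computation path of N on x depends on the oracle only through its at most
-- P = p(|x|) queries, each of length at most P, and by (h,t)-ambiguity each
-- query is flipped by at most T = t(P) strings of U; so at most P·T strings of U
-- can disturb a given path.  If N^L(O)(x) accepts, every α ∈ C₁ must disturb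
-- its accepting path, hence ‖C₁‖ ≤ P·T.  If it rejects, every α ∈ C₁ ∪ C₂
-- yields an accepting path π_α of N^L(O ∪ {α})(x).  Unless ‖C₁‖ ≤ 2PT, pick
-- 2PT+1 elements α of C₁.  If ‖C₂‖ > (2PT+1)·PT, some β ∈ C₂ disturbs none of
-- their paths, and as at most 2PT strings disturb π_β (relative to O ∪ {β} or
-- to O), some picked α disturbs neither.  Then π_α and π_β both survive in
-- L(O ∪ {α, β}), where the accepting path is unique, so they make the same
-- queries; α does not flip these relative to O, so π_α is an accepting path of
-- N^L(O)(x), a contradiction.  The counting is classical, which is why the
-- conclusion is double-negated.

module Submission where

open import Defs
open import Level using (0ℓ)
open import Data.Nat using (ℕ; zero; suc; _+_; _*_; _≤_; z≤n; s≤s; s≤s⁻¹; _≤?_)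
open import Data.Nat.Properties
open import Data.Nat.Tactic.RingSolver using (solve-∀)
open import Data.Fin.Properties using (toℕ-injective)
open import Data.List using (List; []; _∷_; [_]; _++_; length; reverse; take; lookup)
open import Data.List.Properties using (length-++; length-reverse; length-take; ∷-injectiveˡ; ∷-injectiveʳ)
open import Data.List.Relation.Unary.All using (All; []; _∷_)
import Data.List.Relation.Unary.All as All
import Data.List.Relation.Unary.All.Properties as All
open import Data.List.Relation.Unary.AllPairs using ([]; _∷_)
import Data.List.Relation.Unary.Any as Any
open import Data.List.Relation.Unary.Unique.Propositional using (Unique)
import Data.List.Relation.Unary.Unique.Propositional.Properties as Unique
open import Data.List.Membership.Propositional using (_∈_)
open import Data.Product using (Σ; ∃₂; _×_; _,_; proj₁; proj₂)
open import Data.Sum using (_⊎_; inj₁; inj₂)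
import Data.Sum as Sum
open import Data.Empty using (⊥-elim)
open import Effect.Monad using (RawMonad)
open import Function using (_∘_; const; id)
open import Function.Bundles using (_⇔_; mk⇔; Equivalence)
open import Function.Construct.Composition using (_⇔-∘_)
open import Function.Construct.Symmetry using (⇔-sym)
open import Relation.Nullary using (¬_; yes; no)
open import Relation.Nullary.Decidable using (decidable-stable; ¬¬-excluded-middle)
open import Relation.Nullary.Negation using (¬¬-Monad; contradiction)
open import Relation.Binary.PropositionalEquality using (_≡_; refl; sym; trans; cong; cong₂; subst)
open import Relation.Unary using (Pred; _⊆_; _∪_; _∩_; ∁; ∅; ｛_｝; _≐_)
open import Relation.Unary.Properties using (≐-refl; ≐-sym; ≐-trans)

open RawMonad (¬¬-Monad {0ℓ})

¬¬-All : {A : Set} {P : Pred A 0ℓ} {xs : List A} → All (λ a → ¬ ¬ P a) xs → ¬ ¬ All P xs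
¬¬-All = All.sequenceM _ ¬¬-Monad

-- If X ⇔ ¬ Y fails, then X and Y are both refutable, hence equivalent.
¬[⇔¬]⇒¬¬⇔ : {X Y : Set} → ¬ (X ⇔ (¬ Y)) → ¬ ¬ (Y ⇔ X)
¬[⇔¬]⇒¬¬⇔ {X} {Y} ¬[X⇔¬Y] ¬[Y⇔X] = ¬[Y⇔X] (mk⇔ (⊥-elim ∘ ¬Y) (⊥-elim ∘ ¬X))
  where
  ¬X : ¬ X
  ¬X x = ¬[X⇔¬Y] (mk⇔ (λ _ y → ¬[Y⇔X] (mk⇔ (const x) (const y))) (const x))
  ¬Y : ¬ Y
  ¬Y y = ¬[X⇔¬Y] (mk⇔ (⊥-elim ∘ ¬X) (contradiction y))

⟦⟧-mono-≤ : ∀ (t : Poly) {m n} → m ≤ n → ⟦ t ⟧ m ≤ ⟦ t ⟧ n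
⟦⟧-mono-≤ []       m≤n = z≤n
⟦⟧-mono-≤ (c ∷ cs) m≤n = +-monoʳ-≤ c (*-mono-≤ m≤n (⟦⟧-mono-≤ cs m≤n))

ab+ab≤2ab[ab+1] : ∀ a b → a * b + a * b ≤ 2 * a * b * (a * b + 1)
ab+ab≤2ab[ab+1] a b = ≤-trans (m≤m+n (a * b + a * b) _) (≤-reflexive (split a b))
  where
  split : ∀ a b → a * b + a * b + 2 * a * b * (a * b) ≡ 2 * a * b * (a * b + 1)
  split = solve-∀

[1+2ab]ab≤2ab[ab+1] : ∀ a b → suc (a * b + a * b) * (a * b) ≤ 2 * a * b * (a * b + 1)
[1+2ab]ab≤2ab[ab+1] a b = ≤-trans (m≤m+n (suc (a * b + a * b) * (a * b)) _) (≤-reflexive (split a b))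
  where
  split : ∀ a b → suc (a * b + a * b) * (a * b) + a * b ≡ 2 * a * b * (a * b + 1)
  split = solve-∀

private
  variable
    A B C A′ B′ S S′ O U : StrSet
    α β w : Str
    a b m n : ℕ

≐⇒⇔ : S ≐ S′ → S w ⇔ S′ w
≐⇒⇔ (S⊆S′ , S′⊆S) = mk⇔ S⊆S′ S′⊆S

∪-cong : A ≐ A′ → B ≐ B′ → A ∪ B ≐ A′ ∪ B′
∪-cong (A⊆A′ , A′⊆A) (B⊆B′ , B′⊆B) = Sum.map A⊆A′ B⊆B′ , Sum.map A′⊆A B′⊆B

∪-swapʳ : ∀ {A B C : StrSet} → (A ∪ B) ∪ C ≐ (A ∪ C) ∪ B
∪-swapʳ {A} {B} {C} = swap {A} {B} {C} , swap {A} {C} {B}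
  where
  swap : ∀ {A B C : StrSet} → (A ∪ B) ∪ C ⊆ (A ∪ C) ∪ B
  swap (inj₁ (inj₁ a)) = inj₁ (inj₁ a)
  swap (inj₁ (inj₂ b)) = inj₂ b
  swap (inj₂ c)        = inj₁ (inj₂ c)

∪-set-[] : A ∪ set [] ≐ A
∪-set-[] = Sum.[ id , (λ ()) ] , inj₁

∪-set-[_] : ∀ α → A ∪ set [ α ] ≐ A ∪ ｛ α ｝
∪-set-[ α ] = ∪-cong ≐-refl ((λ { (Any.here α≡) → sym α≡ ; (Any.there ()) }) , (λ α≡ → Any.here (sym α≡)))

Disjoint-∪｛｝ : Disjoint O U → ¬ U α → Disjoint (O ∪ ｛ α ｝) U
Disjoint-∪｛｝ O#U _   w (inj₁ Ow)   Uw = O#U w Ow Uw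
Disjoint-∪｛｝ _   ¬Uα w (inj₂ refl) Uw = ¬Uα Uw


CardLe-stable : ¬ ¬ CardLe C n → CardLe C n
CardLe-stable {n = n} ¬¬bounded ws ws! ws∈C =
  decidable-stable (length ws ≤? n) (λ ws≰n → ¬¬bounded λ bounded → ws≰n (bounded ws ws! ws∈C))

CardLe-⊆¬¬ : (∀ {α} → B α → ¬ ¬ A α) → CardLe A n → CardLe B n
CardLe-⊆¬¬ {n = n} B⊆¬¬A bounded ws ws! ws∈B =
  decidable-stable (length ws ≤? n) (bounded ws ws! <$> ¬¬-All (All.map B⊆¬¬A ws∈B))

CardLe-⊆ : B ⊆ A → CardLe A n → CardLe B n
CardLe-⊆ B⊆A bounded ws ws! ws∈B = bounded ws ws! (All.map B⊆A ws∈B)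

CardLe-≤ : m ≤ n → CardLe C m → CardLe C n
CardLe-≤ m≤n bounded ws ws! ws∈C = ≤-trans (bounded ws ws! ws∈C) m≤n

CardLe-∅ : CardLe ∅ 0
CardLe-∅ []       _ _        = z≤n
CardLe-∅ (_ ∷ _)  _ (() ∷ _)

CardLe-∖ : CardLe C (suc n) → C α → CardLe (C ∩ ∁ ｛ α ｝) n
CardLe-∖ bounded Cα ws ws! ws∈ =
  s≤s⁻¹ (bounded (_ ∷ ws) (All.map proj₂ ws∈ ∷ ws!) (Cα ∷ All.map proj₁ ws∈))

CardLe-∪ : CardLe A a → CardLe B b → CardLe (A ∪ B) (a + b)
CardLe-∪ _ _ [] _ _ = z≤n
CardLe-∪ {a = zero} boundedA _ (w ∷ _) _ (inj₁ Aw ∷ _) =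
  contradiction (boundedA [ w ] ([] ∷ []) (Aw ∷ [])) λ ()
CardLe-∪ {a = suc a} boundedA boundedB (w ∷ ws) (w∉ws ∷ ws!) (inj₁ Aw ∷ ws∈) =
  s≤s (CardLe-∪ (CardLe-∖ boundedA Aw) boundedB ws ws!
        (All.zipWith (λ (w≢ , AB) → Sum.map₁ (_, w≢) AB) (w∉ws , ws∈)))
CardLe-∪ {b = zero} _ boundedB (w ∷ _) _ (inj₂ Bw ∷ _) =
  contradiction (boundedB [ w ] ([] ∷ []) (Bw ∷ [])) λ ()
CardLe-∪ {a = a} {b = suc b} boundedA boundedB (w ∷ ws) (w∉ws ∷ ws!) (inj₂ Bw ∷ ws∈) =
  ≤-trans (s≤s (CardLe-∪ boundedA (CardLe-∖ boundedB Bw) ws ws!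
                 (All.zipWith (λ (w≢ , AB) → Sum.map₂ (_, w≢) AB) (w∉ws , ws∈))))
          (≤-reflexive (sym (+-suc a b)))

⋃ : {I : Set} (is : List I) → (∀ {i} → i ∈ is → StrSet) → StrSet
⋃ is F α = ∃₂ λ i (i∈is : i ∈ is) → F i∈is α

CardLe-⋃ : {I : Set} (is : List I) {F : ∀ {i} → i ∈ is → StrSet} →
           (∀ {i} (i∈is : i ∈ is) → CardLe (F i∈is) n) → CardLe (⋃ is F) (length is * n)
CardLe-⋃ []       _       = CardLe-⊆ (λ { (_ , () , _) }) CardLe-∅
CardLe-⋃ (i ∷ is) {F} bounded =
  CardLe-⊆ uncons (CardLe-∪ (bounded (Any.here refl)) (CardLe-⋃ is (bounded ∘ Any.there)))
  where
  uncons : ⋃ (i ∷ is) F ⊆ F (Any.here refl) ∪ ⋃ is (F ∘ Any.there)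
  uncons (_ , Any.here refl , f)   = inj₁ f
  uncons (j , Any.there j∈is , f) = inj₂ (j , j∈is , f)

¬CardLe⇒¬¬distinct : ¬ CardLe C n →
  ¬ ¬ (Σ (List Str) λ ws → Unique ws × All C ws × length ws ≡ suc n)
¬CardLe⇒¬¬distinct {n = n} ¬bounded ¬distinct = ¬bounded λ ws ws! ws∈C →
  decidable-stable (length ws ≤? n) λ ws≰n →
    ¬distinct (take (suc n) ws , Unique.take⁺ (suc n) ws! , All.take⁺ (suc n) ws∈C ,
               trans (length-take (suc n) ws) (m≤n⇒m⊓n≡m (≰⇒> ws≰n)))


Agree : StrSet → StrSet → List Str → Set
Agree S S′ = All (λ w → S w ⇔ S′ w)

module Machine (N : NOTM) where
  open NOTM N using (k)
  open Config

  cells : Tape k → ℕ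
  cells (tape l _ r) = length l + length r

  length-bitPrefix : (s : List (Sym k)) → length (bitPrefix s) ≤ length s
  length-bitPrefix []            = z≤n
  length-bitPrefix (blank ∷ s)   = z≤n
  length-bitPrefix (bit _ ∷ s)   = s≤s (length-bitPrefix s)
  length-bitPrefix (extra _ ∷ s) = z≤n

  length-queryString : (t : Tape k) → length (queryString t) ≤ suc (cells t)
  length-queryString (tape l a r) = begin
    length (bitPrefix (reverse l ++ a ∷ r))   ≤⟨ length-bitPrefix (reverse l ++ a ∷ r) ⟩
    length (reverse l ++ a ∷ r)               ≡⟨ length-++ (reverse l) ⟩
    length (reverse l) + suc (length r)       ≡⟨ cong (_+ suc (length r)) (length-reverse l) ⟩
    length l + suc (length r)                 ≡⟨ +-suc (length l) (length r) ⟩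
    suc (length l + length r)                 ∎
    where open ≤-Reasoning

  cells-move : ∀ mv (t : Tape k) → cells (move mv t) ≤ suc (cells t)
  cells-move left  (tape []      a r)       = n≤1+n _
  cells-move left  (tape (b ∷ l) a r)       = ≤-trans (≤-reflexive (+-suc (length l) (length r))) (n≤1+n _)
  cells-move right (tape l       a [])      = ≤-refl
  cells-move right (tape l       a (b ∷ r)) = s≤s (+-monoʳ-≤ (length l) (n≤1+n _))
  cells-move stay  t                        = n≤1+n _

  cells-step : ∀ {S c c′} → Step N S c c′ → cells (ot c′) ≤ suc (cells (ot c))
  cells-step {c = c} (choose _ _ _ i) = cells-applyT c (lookup (options N c) i)
    where
    cells-applyT : ∀ c tr → cells (ot (applyT N c tr)) ≤ suc (cells (ot c))
    cells-applyT (conf _ _ (tape l _ r)) (_ , _ , b , _ , mv) = cells-move mv (tape l b r)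
  cells-step (ask-yes _ _) = z≤n
  cells-step (ask-no _ _)  = z≤n

  cells-initConfig : ∀ x → cells (ot (initConfig N x)) ≡ 0
  cells-initConfig []      = refl
  cells-initConfig (_ ∷ _) = refl

  query : ∀ {S c c′} → Step N S c c′ → List Str
  query           (choose _ _ _ _) = []
  query {c = c} (ask-yes _ _)    = [ queryString (ot c) ]
  query {c = c} (ask-no _ _)     = [ queryString (ot c) ]

  queries : ∀ {S c n c′} → Steps N S c n c′ → List Str
  queries done     = []
  queries (s ∷ ss) = query s ++ queries ss

  length-query : ∀ {S c c′} (s : Step N S c c′) → length (query s) ≤ 1
  length-query (choose _ _ _ _) = z≤n
  length-query (ask-yes _ _)    = ≤-refl
  length-query (ask-no _ _)     = ≤-refl

  length-queries : ∀ {S c n c′} (ss : Steps N S c n c′) → length (queries ss) ≤ n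
  length-queries done     = z≤n
  length-queries (s ∷ ss) =
    ≤-trans (≤-reflexive (length-++ (query s))) (+-mono-≤ (length-query s) (length-queries ss))

  query-short : ∀ {S c c′} (s : Step N S c c′) → All (λ w → length w ≤ suc (cells (ot c))) (query s)
  query-short (choose _ _ _ _)    = []
  query-short {c = c} (ask-yes _ _) = length-queryString (ot c) ∷ []
  query-short {c = c} (ask-no _ _)  = length-queryString (ot c) ∷ []

  queries-short : ∀ {S c n c′} (ss : Steps N S c n c′) →
                  All (λ w → length w ≤ n + cells (ot c)) (queries ss)
  queries-short done = []
  queries-short {c = c} {suc n} (_∷_ {c′ = c′} s ss) =
    All.++⁺ (All.map (λ ≤cells → ≤-trans ≤cells (s≤s (m≤n+m _ n))) (query-short s))
            (All.map (λ ≤cells′ → ≤-trans ≤cells′ grow) (queries-short ss))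
    where
    grow : n + cells (ot c′) ≤ suc (n + cells (ot c))
    grow = ≤-trans (+-monoʳ-≤ n (cells-step s)) (≤-reflexive (+-suc n _))

  step-transfer : ∀ {S S′ c c′} (s : Step N S c c′) → Agree S S′ (query s) →
                  Σ (Step N S′ c c′) λ s′ → label N s′ ≡ label N s
  step-transfer (choose ≢acc ≢rej ≢qry i) []           = choose ≢acc ≢rej ≢qry i , refl
  step-transfer (ask-yes ≡qry Sq)         (S⇔S′ ∷ []) = ask-yes ≡qry (Equivalence.to S⇔S′ Sq) , refl
  step-transfer (ask-no ≡qry ¬Sq)         (S⇔S′ ∷ []) = ask-no ≡qry (¬Sq ∘ Equivalence.from S⇔S′) , refl

  transfer : ∀ {S S′ c n c′} (ss : Steps N S c n c′) → Agree S S′ (queries ss) →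
             Σ (Steps N S′ c n c′) λ ss′ → trace N ss′ ≡ trace N ss
  transfer done     _     = done , refl
  transfer (s ∷ ss) agree =
    let s′ , s′≡ = step-transfer s (All.++⁻ˡ (query s) agree)
        ss′ , ss′≡ = transfer ss (All.++⁻ʳ (query s) agree)
    in s′ ∷ ss′ , cong₂ _∷_ s′≡ ss′≡

  pick-injective : ∀ {i j} → pick {N} i ≡ pick j → i ≡ j
  pick-injective refl = refl

  step-deterministic : ∀ {S S′ c c₁ c₁′} (s : Step N S c c₁) (s′ : Step N S′ c c₁′) →
                       label N s ≡ label N s′ → c₁ ≡ c₁′ × query s ≡ query s′
  step-deterministic (choose _ _ _ i) (choose _ _ _ j) i≡j
    with toℕ-injective (pick-injective i≡j)
  ... | refl = refl , refl
  step-deterministic (ask-yes _ _)    (ask-yes _ _)    _  = refl , refl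
  step-deterministic (ask-no _ _)     (ask-no _ _)     _  = refl , refl
  step-deterministic (choose _ _ _ _) (ask-yes _ _)    ()
  step-deterministic (choose _ _ _ _) (ask-no _ _)     ()
  step-deterministic (ask-yes _ _)    (choose _ _ _ _) ()
  step-deterministic (ask-yes _ _)    (ask-no _ _)     ()
  step-deterministic (ask-no _ _)     (choose _ _ _ _) ()
  step-deterministic (ask-no _ _)     (ask-yes _ _)    ()

  queries-determined : ∀ {S S′ c n n′ c₁ c₁′} (ss : Steps N S c n c₁) (ss′ : Steps N S′ c n′ c₁′) →
                       trace N ss ≡ trace N ss′ → queries ss ≡ queries ss′
  queries-determined done     done       _  = refl
  queries-determined done     (_ ∷ _)    ()
  queries-determined (_ ∷ _)  done       ()
  queries-determined (s ∷ ss) (s′ ∷ ss′) eq with step-deterministic s s′ (∷-injectiveˡ eq)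
  ... | refl , query≡ = cong₂ _++_ query≡ (queries-determined ss ss′ (∷-injectiveʳ eq))

  accQueries : ∀ {S x} → AccPath N S x → List Str
  accQueries (_ , _ , ss , _) = queries ss

  AccPath-transfer : ∀ {S S′ x} (π : AccPath N S x) → Agree S S′ (accQueries π) →
                     Σ (AccPath N S′ x) λ π′ → accTrace N π′ ≡ accTrace N π
  AccPath-transfer (c , n , ss , acc) agree =
    let ss′ , ss′≡ = transfer ss agree in (c , n , ss′ , acc) , ss′≡

  Accepts-resp-≐ : ∀ {S S′ x} → S ≐ S′ → Accepts N S x → Accepts N S′ x
  Accepts-resp-≐ S≐S′ π = proj₁ (AccPath-transfer π (All.universal (λ _ → ≐⇒⇔ S≐S′) _))

  accQueries-determined : ∀ {S S′ x} (π : AccPath N S x) (π′ : AccPath N S′ x) →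
                          accTrace N π ≡ accTrace N π′ → accQueries π ≡ accQueries π′
  accQueries-determined (_ , _ , ss , _) (_ , _ , ss′ , _) = queries-determined ss ss′

  module _ {p : Poly} (runtime : RunTimeBound N p) where

    length-accQueries : ∀ {S x} (π : AccPath N S x) → length (accQueries π) ≤ ⟦ p ⟧ (length x)
    length-accQueries {S} {x} (c , n , ss , _) = ≤-trans (length-queries ss) (runtime S x n c ss)

    accQueries-short : ∀ {S x} (π : AccPath N S x) →
                       All (λ w → length w ≤ ⟦ p ⟧ (length x)) (accQueries π)
    accQueries-short {S} {x} (c , n , ss , _) =
      All.map (λ short → ≤-trans short (≤-trans (≤-reflexive n+cells≡n) (runtime S x n c ss)))
              (queries-short ss)
      where
      n+cells≡n : n + cells (ot (initConfig N x)) ≡ n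
      n+cells≡n = trans (cong (n +_) (cells-initConfig x)) (+-identityʳ n)

Flips : PartialSetFun → StrSet → StrSet → Str → StrSet
Flips L O U w α =
  U α × Σ (Dom L O) λ d₀ → Σ (Dom L (O ∪ ｛ α ｝)) λ d → (app L (O ∪ ｛ α ｝) d w ⇔ (¬ app L O d₀ w))

Flippers : PartialSetFun → StrSet → StrSet → List Str → StrSet
Flippers L O U qs = ⋃ qs (λ {w} _ → Flips L O U w)

ExtensionsDefined : ℕ → PartialSetFun → StrSet → StrSet → Set
ExtensionsDefined h L O U = ∀ A → All U A → length A ≤ h → Dom L (O ∪ set A)

Flips-bounded : ∀ {h t L} → Ambiguous h t L → Disjoint O U → ExtensionsDefined h L O U →
                length w ≤ n → CardLe (Flips L O U w) (⟦ t ⟧ n)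
Flips-bounded {O = O} {U} {t = t} amb O#U defined |w|≤n with amb O U O#U
... | inj₁ (A , A⊆U , |A|≤h , undefined) = contradiction (defined A A⊆U |A|≤h) undefined
... | inj₂ bounded                        = CardLe-≤ (⟦⟧-mono-≤ t |w|≤n) (bounded _)

unflipped⇒¬¬agree : ∀ L U {qs} → U α → (d₀ : Dom L O) (d : Dom L (O ∪ ｛ α ｝)) →
                    ¬ Flippers L O U qs α → ¬ ¬ Agree (app L O d₀) (app L (O ∪ ｛ α ｝) d) qs
unflipped⇒¬¬agree _ _ Uα d₀ d unflipped =
  ¬¬-All (All.tabulate λ w∈qs → ¬[⇔¬]⇒¬¬⇔ λ flip → unflipped (_ , w∈qs , Uα , d₀ , d , flip))

-- A record rather than a Σ-type, so that α can be inferred from the type.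
record AcceptingExtension (N : NOTM) (L : PartialSetFun) (O U : StrSet) (x α : Str) : Set where
  constructor extension
  field
    member  : U α
    defined : Dom L (O ∪ ｛ α ｝)
    accepts : Accepts N (app L (O ∪ ｛ α ｝) defined) x

flipped⇒¬¬AcceptingExtension : ∀ {N L x} {d₀ : Dom L O} → ¬ Accepts N (app L O d₀) x →
                               FlipSet N L O U x α → ¬ ¬ AcceptingExtension N L O U x α
flipped⇒¬¬AcceptingExtension {N = N} {L} {d₀ = d₀} rejects (Uα , d₀′ , d , flip) ¬accepting =
  rejects (Machine.Accepts-resp-≐ N (app-resp L ≐-refl d₀′ d₀)
            (Equivalence.from flip λ accepts → ¬accepting (extension Uα d accepts)))

module FlipCounting {h t L} (amb : Ambiguous h t L) {N p} (runtime : RunTimeBound N p) (x : Str) where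
  open Machine N

  P T : ℕ
  P = ⟦ p ⟧ (length x)
  T = ⟦ t ⟧ P

  pathFlippers-bounded : Disjoint O U → ExtensionsDefined h L O U → (π : AccPath N S x) →
                         CardLe (Flippers L O U (accQueries π)) (P * T)
  pathFlippers-bounded O#U defined π =
    CardLe-≤ (*-monoˡ-≤ T (length-accQueries {p} runtime π))
      (CardLe-⋃ (accQueries π) λ w∈qs →
        Flips-bounded {t = t} {L} amb O#U defined (All.lookup (accQueries-short {p} runtime π) w∈qs))

  accepting⇒FlipSet-bounded : Disjoint O U → ExtensionsDefined h L O U → (d₀ : Dom L O) →
                              Accepts N (app L O d₀) x → CardLe (FlipSet N L O U x) (P * T)
  accepting⇒FlipSet-bounded {O = O} {U} O#U defined d₀ π =
    CardLe-⊆¬¬ flipper-flips-π (pathFlippers-bounded O#U defined π)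
    where
    flipper-flips-π : FlipSet N L O U x α → ¬ ¬ Flippers L O U (accQueries π) α
    flipper-flips-π (Uα , d₀′ , d , flip) unflipped =
      unflipped⇒¬¬agree L U Uα d₀ d unflipped λ agree →
        Equivalence.to flip (Accepts-resp-≐ (app-resp L ≐-refl d₀ d₀′) π)
                            (proj₁ (AccPath-transfer π agree))

module Setting
  (h : ℕ) (1≤h : 1 ≤ h) (t : Poly) (N : NOTM) (p : Poly) (runtime : RunTimeBound N p)
  (x : Str) (O U₁ U₂ : StrSet)
  (O#U₁ : Disjoint O U₁) (O#U₂ : Disjoint O U₂) (U₁#U₂ : Disjoint U₁ U₂)
  (L : PartialSetFun) (amb : Ambiguous h t L)
  (defined : ∀ (A₁ A₂ : List Str) → All U₁ A₁ → All U₂ A₂ →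
     length A₁ ≤ h → length A₂ ≤ h → Dom L ((O ∪ set A₁) ∪ set A₂))
  (unique : ∀ (A₁ A₂ : List Str) → All U₁ A₁ → All U₂ A₂ →
     length A₁ ≤ 1 → length A₂ ≤ 1 →
     (d : Dom L ((O ∪ set A₁) ∪ set A₂)) →
     AtMostOneAccPath N (app L ((O ∪ set A₁) ∪ set A₂) d) x)
  where
  open Machine N
  open FlipCounting {t = t} {L} amb {p = p} runtime x public

  d₀ : Dom L O
  d₀ = dom-resp L (≐-trans ∪-set-[] ∪-set-[]) (defined [] [] [] [] z≤n z≤n)

  defined₁ : ExtensionsDefined h L O U₁
  defined₁ A A⊆U₁ |A|≤h = dom-resp L ∪-set-[] (defined A [] A⊆U₁ [] |A|≤h z≤n)

  defined-α : U₁ α → ExtensionsDefined h L (O ∪ ｛ α ｝) U₂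
  defined-α {α} Uα A A⊆U₂ |A|≤h =
    dom-resp L (∪-cong ∪-set-[ α ] ≐-refl) (defined [ α ] A (Uα ∷ []) A⊆U₂ 1≤h |A|≤h)

  defined-β : U₂ β → ExtensionsDefined h L (O ∪ ｛ β ｝) U₁
  defined-β {β} Uβ A A⊆U₁ |A|≤h =
    dom-resp L (≐-trans ∪-swapʳ (∪-cong ∪-set-[ β ] ≐-refl)) (defined A [ β ] A⊆U₁ (Uβ ∷ []) |A|≤h 1≤h)

  U₂-flippers : AcceptingExtension N L O U₁ x α → StrSet
  U₂-flippers {α} (extension _ _ πα) = Flippers L (O ∪ ｛ α ｝) U₂ (accQueries πα)

  U₁-flippers : AcceptingExtension N L O U₂ x β → StrSet
  U₁-flippers {β} (extension _ _ πβ) =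
    Flippers L (O ∪ ｛ β ｝) U₁ (accQueries πβ) ∪ Flippers L O U₁ (accQueries πβ)

  U₂-flippers-bounded : (E : AcceptingExtension N L O U₁ x α) → CardLe (U₂-flippers E) (P * T)
  U₂-flippers-bounded (extension Uα _ πα) =
    pathFlippers-bounded (Disjoint-∪｛｝ O#U₂ (U₁#U₂ _ Uα)) (defined-α Uα) πα

  U₁-flippers-bounded : (E : AcceptingExtension N L O U₂ x β) → CardLe (U₁-flippers E) (P * T + P * T)
  U₁-flippers-bounded (extension Uβ _ πβ) =
    CardLe-∪ (pathFlippers-bounded (Disjoint-∪｛｝ O#U₁ λ U₁β → U₁#U₂ _ U₁β Uβ) (defined-β Uβ) πβ)
             (pathFlippers-bounded O#U₁ defined₁ πβ)

  unflipped-pair⇒¬¬accepts : (Eα : AcceptingExtension N L O U₁ x α)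
                             (Eβ : AcceptingExtension N L O U₂ x β) →
                             ¬ U₂-flippers Eα β → ¬ U₁-flippers Eβ α → ¬ ¬ Accepts N (app L O d₀) x
  unflipped-pair⇒¬¬accepts {α} {β} (extension Uα dα πα) (extension Uβ dβ πβ) β∉flippers α∉flippers =
    do
      πα-agrees ← unflipped⇒¬¬agree L U₂ Uβ dα dαβ β∉flippers
      πβ-agrees ← unflipped⇒¬¬agree L U₁ Uα dβ dβα (α∉flippers ∘ inj₁)
      O-agrees  ← unflipped⇒¬¬agree L U₁ Uα d₀ dα (α∉flippers ∘ inj₂)
      let πα* , πα*≡ = AccPath-transfer πα (to-common dαβ common-α πα-agrees)
          πβ* , πβ*≡ = AccPath-transfer πβ (to-common dβα common-β πβ-agrees)
          same-trace = trans (sym πα*≡)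
                             (trans (unique [ α ] [ β ] (Uα ∷ []) (Uβ ∷ []) ≤-refl ≤-refl d* πα* πβ*) πβ*≡)
          same-queries = accQueries-determined πα πβ same-trace
      pure (proj₁ (AccPath-transfer πα (subst (Agree _ _) (sym same-queries) (All.map ⇔-sym O-agrees))))
    where
    common : StrSet
    common = (O ∪ set [ α ]) ∪ set [ β ]
    d* : Dom L common
    d* = defined [ α ] [ β ] (Uα ∷ []) (Uβ ∷ []) 1≤h 1≤h
    common-α : (O ∪ ｛ α ｝) ∪ ｛ β ｝ ≐ common
    common-α = ≐-sym (≐-trans (∪-cong ∪-set-[ α ] ≐-refl) ∪-set-[ β ])
    common-β : (O ∪ ｛ β ｝) ∪ ｛ α ｝ ≐ common
    common-β = ≐-trans ∪-swapʳ common-α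
    dαβ : Dom L ((O ∪ ｛ α ｝) ∪ ｛ β ｝)
    dαβ = dom-resp L (≐-sym common-α) d*
    dβα : Dom L ((O ∪ ｛ β ｝) ∪ ｛ α ｝)
    dβα = dom-resp L (≐-sym common-β) d*
    to-common : ∀ {S S′ qs} (d′ : Dom L S′) → S′ ≐ common →
                Agree S (app L S′ d′) qs → Agree S (app L common d*) qs
    to-common d′ S′≐common = All.map (λ S⇔S′ → ≐⇒⇔ (app-resp L S′≐common d′ d*) ⇔-∘ S⇔S′)

  rejecting⇒FlipSet₂-bounded : ¬ Accepts N (app L O d₀) x →
    (A : List Str) → Unique A → All (FlipSet N L O U₁ x) A → length A ≡ suc (P * T + P * T) →
    CardLe (FlipSet N L O U₂ x) (suc (P * T + P * T) * (P * T))
  rejecting⇒FlipSet₂-bounded rejects A A! A⊆C₁ |A|≡ = CardLe-stable do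
      Es ← ¬¬-All (All.map (flipped⇒¬¬AcceptingExtension rejects) A⊆C₁)
      pure (subst (CardLe _) (cong (_* (P * T)) |A|≡)
                  (CardLe-⊆¬¬ (C₂⊆¬¬sample-flippers Es)
                              (CardLe-⋃ A λ α∈A → U₂-flippers-bounded (All.lookup Es α∈A))))
    where
    sample-flippers : All (AcceptingExtension N L O U₁ x) A → StrSet
    sample-flippers Es = ⋃ A λ α∈A → U₂-flippers (All.lookup Es α∈A)
    C₂⊆¬¬sample-flippers : (Es : All (AcceptingExtension N L O U₁ x) A) →
                           FlipSet N L O U₂ x β → ¬ ¬ sample-flippers Es β
    C₂⊆¬¬sample-flippers Es Cβ = do
      no β∉sample ← ¬¬-excluded-middle
        where yes β∈sample → pure β∈sample
      Eβ ← flipped⇒¬¬AcceptingExtension rejects Cβ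
      A⊆flippers ← ¬¬-All (All.tabulate λ α∈A α∉flippers →
        unflipped-pair⇒¬¬accepts (All.lookup Es α∈A) Eβ
          (λ β∈flippers → β∉sample (_ , α∈A , β∈flippers)) α∉flippers rejects)
      pure (contradiction (subst (_≤ P * T + P * T) |A|≡ (U₁-flippers-bounded Eβ A A! A⊆flippers)) 1+n≰n)

lemma4p8 : (h : ℕ) → 1 ≤ h → (t : Poly) →
    (N : NOTM) → (p : Poly) → RunTimeBound N p →
    (x : Str) → (O U₁ U₂ : StrSet) →
    Disjoint O U₁ → Disjoint O U₂ → Disjoint U₁ U₂ →
    (L : PartialSetFun) → Ambiguous h t L →
    (∀ (A₁ A₂ : List Str) → All U₁ A₁ → All U₂ A₂ →
       length A₁ ≤ h → length A₂ ≤ h → Dom L ((O ∪ set A₁) ∪ set A₂)) →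
    (∀ (A₁ A₂ : List Str) → All U₁ A₁ → All U₂ A₂ →
       length A₁ ≤ 1 → length A₂ ≤ 1 →
       (d : Dom L ((O ∪ set A₁) ∪ set A₂)) →
       AtMostOneAccPath N (app L ((O ∪ set A₁) ∪ set A₂) d) x) →
    ¬ ¬ (CardLe (FlipSet N L O U₁ x)
           (2 * ⟦ p ⟧ (length x) * ⟦ t ⟧ (⟦ p ⟧ (length x))
              * (⟦ p ⟧ (length x) * ⟦ t ⟧ (⟦ p ⟧ (length x)) + 1))
         ⊎ CardLe (FlipSet N L O U₂ x)
           (2 * ⟦ p ⟧ (length x) * ⟦ t ⟧ (⟦ p ⟧ (length x))
              * (⟦ p ⟧ (length x) * ⟦ t ⟧ (⟦ p ⟧ (length x)) + 1)))
lemma4p8 h 1≤h t N p runtime x O U₁ U₂ O#U₁ O#U₂ U₁#U₂ L amb defined unique = do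
    no rejects ← ¬¬-excluded-middle
      where yes accepts → pure (inj₁ (CardLe-≤ (≤-trans (m≤m+n (P * T) (P * T)) (ab+ab≤2ab[ab+1] P T))
                                         (accepting⇒FlipSet-bounded O#U₁ defined₁ d₀ accepts)))
    no large ← ¬¬-excluded-middle
      where yes small → pure (inj₁ (CardLe-≤ (ab+ab≤2ab[ab+1] P T) small))
    A , A! , A⊆C₁ , |A|≡ ← ¬CardLe⇒¬¬distinct large
    pure (inj₂ (CardLe-≤ ([1+2ab]ab≤2ab[ab+1] P T) (rejecting⇒FlipSet₂-bounded rejects A A! A⊆C₁ |A|≡)))
  where open Setting h 1≤h t N p runtime x O U₁ U₂ O#U₁ O#U₂ U₁#U₂ L amb defined unique
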